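{- Let $n \ge 1$, $m\ge 1$, let $0=s[0]<s[1]<\dots<s[m]=n$ be integers, let $d_1,\dots,d_n$ and $B$ be positive integers, and let $a_1,\dots,a_{m-1}$ be positive integers with $a_1\le a_2\le\dots\le a_{m-1}\le B$. Define $\bar a_0=0$, $\bar a_m=B$ and, recursively for $i=1,\dots,m-1$, $\bar a_i=\min\{\bar a_{i-1}+\sum_{k=s[i-1]+1}^{s[i]} d_k,\ a_i\}$. Suppose that for every $i\in\{1,\dots,m\}$ one has $\sum_{k=s[i-1]+1}^{n} d_k \ge B-\bar a_{i-1}$. Then for every $v\in\{1,\dots,m\}$ the problem $\textsc{Rap}(v,v)$, i.e. the system $$\sum_{i=s[v-1]+1}^{s[v]} x_i=\bar a_v-\bar a_{v-1},\qquad 0\le x_i\le d_i\ \ (i=s[v-1]+1,\dots,s[v]),$$ admits a feasible solution (indeed one with integer entries).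
   Context: This is the resource allocation subproblem attached to the $v$-th block of variables $x_{s[v-1]+1},\dots,x_{s[v]}$ in the nested resource allocation problem: minimize $\sum_{i=1}^n f_i(x_i)$ subject to $\sum_{k=1}^{s[i]}x_k\le a_i$ for $i=1,\dots,m-1$, $\sum_{i=1}^n x_i=B$, $0\le x_i\le d_i$, where each $f_i:[0,d_i]\to\mathbb{R}$ is proper convex. The values $\bar a_i$ are the "tightened" right-hand sides computed by the algorithm, and the hypothesis on $\sum d_k$ is the algorithm's feasibility check. -}

module Defs where

open import Data.Nat using (ℕ; zero; suc; _∸_)
open import Data.Nat.Properties using (_≟_)
open import Data.Integer using (ℤ; _+_; _⊓_; 0ℤ)
open import Data.Bool using (if_then_else_)
open import Relation.Nullary using (does)

sumFrom : (ℕ → ℤ) → ℕ → ℕ → ℤ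
sumFrom f lo zero    = 0ℤ
sumFrom f lo (suc c) = f (suc lo) + sumFrom f (suc lo) c

-- rangeSum f lo hi = Σ_{k = lo+1}^{hi} f k   (empty, i.e. 0, when hi ≤ lo)
rangeSum : (ℕ → ℤ) → ℕ → ℕ → ℤ
rangeSum f lo hi = sumFrom f lo (hi ∸ lo)

abarRec : (s : ℕ → ℕ) (d : ℕ → ℤ) (a : ℕ → ℤ) → ℕ → ℤ
abarRec s d a zero    = 0ℤ
abarRec s d a (suc i) = (abarRec s d a i + rangeSum d (s i) (s (suc i))) ⊓ a (suc i)

-- ā_i : equals B at i = m, and the recursion above for i < m (ā_0 = 0 since m ≥ 1).
abar : (m : ℕ) (B : ℤ) (s : ℕ → ℕ) (d : ℕ → ℤ) (a : ℕ → ℤ) → ℕ → ℤ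
abar m B s d a i = if does (i ≟ m) then B else abarRec s d a i

-- Such a vector
-- exists as soon as 0 ≤ T ≤ D, where D is the sum of the caps d_k over the
-- block: fill the block greedily, giving the first variable min(T, d_k) and
-- distributing the remainder over the rest of the block ('boxedSum-exists').
--
-- For v < m the recursion gives
-- ā_v = min(ā_{v-1} + D, a_v), and since ā_{v-1} ≤ a_v (the caps a_i are
-- positive and nondecreasing) the increment lies in [0, D]
-- ('capped-increment-bounds').  For v = m the target is B - ā_{m-1}, which is
-- nonnegative because ā_{m-1} ≤ a_{m-1} ≤ B, and at most D by the feasibility
-- hypothesis at i = m, since the block of v = m ends at s[m] = n.
module Submission where

open import Defs
open import Data.Nat using (ℕ; suc; _∸_) renaming (_≤_ to _≤ℕ_; _<_ to _<ℕ_)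
open import Data.Integer using (ℤ; _≤_; _<_; _-_; 0ℤ)
open import Data.Product using (Σ; _×_)
open import Relation.Binary.PropositionalEquality using (_≡_)

import Data.Nat as ℕ
import Data.Nat.Properties as ℕP
open import Data.Integer using (_+_; -_; _⊓_)
open import Data.Integer.Base using (nonNegative)
import Data.Integer.Properties as ℤP
open import Data.Integer.Tactic.RingSolver using (solve-∀)
open import Data.Product using (_,_; proj₁; proj₂)
open import Data.Sum using (inj₁; inj₂)
open import Relation.Nullary using (¬_; yes; no; contradiction)
open import Relation.Nullary.Decidable using (dec-true; dec-false)
open import Relation.Binary.PropositionalEquality
  using (refl; sym; cong; cong₂; subst; _≢_; module ≡-Reasoning)

add-sub : ∀ x t → x + (t - x) ≡ t
add-sub = solve-∀

add-sub-left : ∀ j k → (j + k) - j ≡ k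
add-sub-left = solve-∀

sub-≤ : ∀ {i j k} → i ≤ j + k → i - j ≤ k
sub-≤ {i} {j} {k} i≤j+k =
  ℤP.≤-trans (ℤP.+-monoˡ-≤ (- j) i≤j+k) (ℤP.≤-reflexive (add-sub-left j k))

-- The part of T left over after taking min(T, c) is at most R, provided
-- T ≤ c + R and R ≥ 0: the remainder of a greedy step fits the rest.
greedy-remainder : ∀ {T c R} → 0ℤ ≤ R → T ≤ c + R → T - T ⊓ c ≤ R
greedy-remainder {T} {c} {R} 0≤R T≤c+R = sub-≤ T≤min+R
  where
  T≤min+R : T ≤ T ⊓ c + R
  T≤min+R with ℤP.≤-total T c
  ... | inj₁ T≤c rewrite ℤP.i≤j⇒i⊓j≡i T≤c = ℤP.i≤i+j T R {{nonNegative 0≤R}}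
  ... | inj₂ c≤T rewrite ℤP.i≥j⇒i⊓j≡j c≤T = T≤c+R

capped-increment-bounds : ∀ {A D c} → 0ℤ ≤ D → A ≤ c →
  (0ℤ ≤ (A + D) ⊓ c - A) × ((A + D) ⊓ c - A ≤ D)
capped-increment-bounds {A} {D} {c} 0≤D A≤c =
  ℤP.i≤j⇒0≤j-i (ℤP.⊓-glb (ℤP.i≤i+j A D {{nonNegative 0≤D}}) A≤c) ,
  sub-≤ (ℤP.i⊓j≤i (A + D) c)

-- Window lo c k: the index k lies in {lo+1, …, lo+c}, the range summed by
-- sumFrom _ lo c.  The lemmas below describe how windows shrink from the left,
-- which is how sumFrom recurses.
Window : ℕ → ℕ → ℕ → Set
Window lo c k = lo <ℕ k × k ≤ℕ lo ℕ.+ c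

window-empty : ∀ {lo k} → ¬ Window lo 0 k
window-empty {lo} (lo<k , k≤lo+0) =
  ℕP.<-irrefl refl (ℕP.<-≤-trans lo<k (subst (_ ≤ℕ_) (ℕP.+-identityʳ lo) k≤lo+0))

window-head : ∀ lo c → Window lo (suc c) (suc lo)
window-head lo c = ℕP.≤-refl , ℕP.m<m+n lo (ℕ.s≤s ℕ.z≤n)

window-tail : ∀ {lo c k} → Window (suc lo) c k → Window lo (suc c) k
window-tail {lo} {c} {k} (1+lo<k , k≤1+lo+c) =
  ℕP.<⇒≤ 1+lo<k , subst (k ≤ℕ_) (sym (ℕP.+-suc lo c)) k≤1+lo+c

window-rest : ∀ {lo c k} → Window lo (suc c) k → k ≢ suc lo → Window (suc lo) c k
window-rest {lo} {c} {k} (lo<k , k≤lo+1+c) k≢1+lo =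
  ℕP.≤∧≢⇒< lo<k (λ e → k≢1+lo (sym e)) , subst (k ≤ℕ_) (ℕP.+-suc lo c) k≤lo+1+c

range⇒window : ∀ {lo hi k} → lo ≤ℕ hi → lo <ℕ k → k ≤ℕ hi → Window lo (hi ∸ lo) k
range⇒window lo≤hi lo<k k≤hi = lo<k , subst (_ ≤ℕ_) (sym (ℕP.m+[n∸m]≡n lo≤hi)) k≤hi

window⇒range : ∀ {lo hi k} → lo ≤ℕ hi → Window lo (hi ∸ lo) k → k ≤ℕ hi
window⇒range lo≤hi (_ , k≤lo+[hi-lo]) = subst (_ ≤ℕ_) (ℕP.m+[n∸m]≡n lo≤hi) k≤lo+[hi-lo]

sumFrom-cong : ∀ {f g : ℕ → ℤ} lo c → (∀ k → Window lo c k → f k ≡ g k) →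
  sumFrom f lo c ≡ sumFrom g lo c
sumFrom-cong lo ℕ.zero    f≗g = refl
sumFrom-cong lo (suc c) f≗g =
  cong₂ _+_ (f≗g (suc lo) (window-head lo c))
            (sumFrom-cong (suc lo) c (λ k w → f≗g k (window-tail w)))

sumFrom-nonneg : ∀ {f : ℕ → ℤ} lo c → (∀ k → Window lo c k → 0ℤ ≤ f k) → 0ℤ ≤ sumFrom f lo c
sumFrom-nonneg lo ℕ.zero    0≤f = ℤP.≤-refl
sumFrom-nonneg lo (suc c) 0≤f =
  ℤP.+-mono-≤ (0≤f (suc lo) (window-head lo c))
              (sumFrom-nonneg (suc lo) c (λ k w → 0≤f k (window-tail w)))

override : ℕ → ℤ → (ℕ → ℤ) → ℕ → ℤ
override j v f i with i ℕ.≟ j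
... | yes _ = v
... | no  _ = f i

override-here : ∀ j v f → override j v f j ≡ v
override-here j v f with j ℕ.≟ j
... | yes _   = refl
... | no  j≢j = contradiction refl j≢j

override-there : ∀ {j v f i} → i ≢ j → override j v f i ≡ f i
override-there {j} {i = i} i≢j with i ℕ.≟ j
... | yes i≡j = contradiction i≡j i≢j
... | no  _   = refl

BoxedSum : (ℕ → ℤ) → ℕ → ℕ → ℤ → Set
BoxedSum d lo c T =
  Σ (ℕ → ℤ) λ x → (sumFrom x lo c ≡ T) × (∀ k → Window lo c k → (0ℤ ≤ x k) × (x k ≤ d k))

prepend : ∀ d lo c {T x₁} → 0ℤ ≤ x₁ → x₁ ≤ d (suc lo) →
  BoxedSum d (suc lo) c (T - x₁) → BoxedSum d lo (suc c) T
prepend d lo c {T} {x₁} 0≤x₁ x₁≤d (x' , sum-x' , x'-bounds) = x , sum-x , x-bounds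
  where
  x : ℕ → ℤ
  x = override (suc lo) x₁ x'

  sum-x : x (suc lo) + sumFrom x (suc lo) c ≡ T
  sum-x = begin
    x (suc lo) + sumFrom x (suc lo) c
      ≡⟨ cong₂ _+_ (override-here (suc lo) x₁ x')
                   (sumFrom-cong (suc lo) c (λ k (1+lo<k , _) →
                     override-there (λ k≡1+lo → ℕP.<-irrefl (sym k≡1+lo) 1+lo<k))) ⟩
    x₁ + sumFrom x' (suc lo) c  ≡⟨ cong (x₁ +_) sum-x' ⟩
    x₁ + (T - x₁)               ≡⟨ add-sub x₁ T ⟩
    T                           ∎
    where open ≡-Reasoning

  x-bounds : ∀ k → Window lo (suc c) k → (0ℤ ≤ x k) × (x k ≤ d k)
  x-bounds k w with k ℕ.≟ suc lo
  ... | yes refl  = 0≤x₁ , x₁≤d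
  ... | no  k≢1+lo = x'-bounds k (window-rest w k≢1+lo)

boxedSum-exists : ∀ d lo c {T} → (∀ k → Window lo c k → 0ℤ ≤ d k) →
  0ℤ ≤ T → T ≤ sumFrom d lo c → BoxedSum d lo c T
boxedSum-exists d lo ℕ.zero    0≤d 0≤T T≤0 =
  (λ _ → 0ℤ) , ℤP.≤-antisym 0≤T T≤0 , λ k w → contradiction w window-empty
boxedSum-exists d lo (suc c) {T} 0≤d 0≤T T≤sum =
  prepend d lo c (ℤP.⊓-glb 0≤T 0≤d₁) (ℤP.i⊓j≤j T d₁)
    (boxedSum-exists d (suc lo) c 0≤d-rest
      (ℤP.i≤j⇒0≤j-i (ℤP.i⊓j≤i T d₁))
      (greedy-remainder (sumFrom-nonneg (suc lo) c 0≤d-rest) T≤sum))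
  where
  d₁ : ℤ
  d₁ = d (suc lo)
  0≤d₁ : 0ℤ ≤ d₁
  0≤d₁ = 0≤d (suc lo) (window-head lo c)
  0≤d-rest : ∀ k → Window (suc lo) c k → 0ℤ ≤ d k
  0≤d-rest k w = 0≤d k (window-tail w)

rangeSum-nonneg : ∀ {f : ℕ → ℤ} {lo hi} → lo ≤ℕ hi →
  (∀ k → lo <ℕ k → k ≤ℕ hi → 0ℤ ≤ f k) → 0ℤ ≤ rangeSum f lo hi
rangeSum-nonneg {lo = lo} {hi} lo≤hi 0≤f =
  sumFrom-nonneg lo (hi ∸ lo) (λ k win@(lo<k , _) → 0≤f k lo<k (window⇒range lo≤hi win))

boxedRange-exists : ∀ d {lo hi T} → lo ≤ℕ hi → (∀ k → lo <ℕ k → k ≤ℕ hi → 0ℤ ≤ d k) →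
  0ℤ ≤ T → T ≤ rangeSum d lo hi →
  Σ (ℕ → ℤ) λ x → (rangeSum x lo hi ≡ T) × (∀ k → lo <ℕ k → k ≤ℕ hi → (0ℤ ≤ x k) × (x k ≤ d k))
boxedRange-exists d {lo} {hi} lo≤hi 0≤d 0≤T T≤D
  with boxedSum-exists d lo (hi ∸ lo) (λ k win@(lo<k , _) → 0≤d k lo<k (window⇒range lo≤hi win)) 0≤T T≤D
... | x , sum-x , x-bounds = x , sum-x , λ k lo<k k≤hi → x-bounds k (range⇒window lo≤hi lo<k k≤hi)

≤-last : ∀ {s : ℕ → ℕ} m → (∀ i → i <ℕ m → s i ≤ℕ s (suc i)) → ∀ {i} → i ≤ℕ m → s i ≤ℕ s m
≤-last ℕ.zero    step ℕ.z≤n = ℕP.≤-refl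
≤-last (suc m) step i≤1+m with ℕP.m≤n⇒m<n∨m≡n i≤1+m
... | inj₂ refl          = ℕP.≤-refl
... | inj₁ (ℕ.s≤s i≤m) =
  ℕP.≤-trans (≤-last m (λ j j<m → step j (ℕP.m<n⇒m<1+n j<m)) i≤m) (step m ℕP.≤-refl)

abar-last : ∀ m B s d a → abar m B s d a m ≡ B
abar-last m B s d a rewrite dec-true (m ℕ.≟ m) refl = refl

abar-below : ∀ {m B s d a i} → i ≢ m → abar m B s d a i ≡ abarRec s d a i
abar-below {m} {i = i} i≢m rewrite dec-false (i ℕ.≟ m) i≢m = refl

-- ā_w ≤ c whenever c ≥ 0 (covering ā_0 = 0) and c ≥ a_w (covering w ≥ 1,
-- where ā_w is a minimum with a_w).
abarRec-≤ : ∀ s d a w {c} → 0ℤ ≤ c → (1 ≤ℕ w → a w ≤ c) → abarRec s d a w ≤ c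
abarRec-≤ s d a ℕ.zero    0≤c a≤c = 0≤c
abarRec-≤ s d a (suc w) 0≤c a≤c = ℤP.≤-trans (ℤP.i⊓j≤j _ (a (suc w))) (a≤c (ℕ.s≤s ℕ.z≤n))

inner-target-bounds : ∀ {m B s d a} w → suc w <ℕ m →
  0ℤ ≤ rangeSum d (s w) (s (suc w)) → abarRec s d a w ≤ a (suc w) →
  (0ℤ ≤ abar m B s d a (suc w) - abar m B s d a w) ×
  (abar m B s d a (suc w) - abar m B s d a w ≤ rangeSum d (s w) (s (suc w)))
inner-target-bounds {m} {B} {s} {d} {a} w v<m 0≤D A≤a
  rewrite abar-below {m} {B} {s} {d} {a} (ℕP.<⇒≢ v<m)
        | abar-below {m} {B} {s} {d} {a} (ℕP.<⇒≢ (ℕP.<-trans (ℕP.n<1+n w) v<m))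
  = capped-increment-bounds 0≤D A≤a

last-target-bounds : ∀ {m B s d a} w → suc w ≡ m → abarRec s d a w ≤ B →
  B - abar m B s d a w ≤ rangeSum d (s w) (s m) →
  (0ℤ ≤ abar m B s d a (suc w) - abar m B s d a w) ×
  (abar m B s d a (suc w) - abar m B s d a w ≤ rangeSum d (s w) (s (suc w)))
last-target-bounds {B = B} {s} {d} {a} w refl A≤B slack
  rewrite abar-last (suc w) B s d a
        | abar-below {suc w} {B} {s} {d} {a} (ℕP.<⇒≢ (ℕP.n<1+n w))
  = ℤP.i≤j⇒0≤j-i A≤B , slack

lemma1 : (n m : ℕ) (s : ℕ → ℕ) (d : ℕ → ℤ) (B : ℤ) (a : ℕ → ℤ) →
    1 ≤ℕ n → 1 ≤ℕ m →
    s 0 ≡ 0 → (∀ i → i <ℕ m → s i <ℕ s (suc i)) → s m ≡ n →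
    (∀ k → 1 ≤ℕ k → k ≤ℕ n → 0ℤ < d k) → 0ℤ < B →
    (∀ i → 1 ≤ℕ i → i <ℕ m → 0ℤ < a i) →
    (∀ i → 1 ≤ℕ i → suc i <ℕ m → a i ≤ a (suc i)) →
    (∀ i → 1 ≤ℕ i → suc i ≡ m → a i ≤ B) →
    (∀ i → 1 ≤ℕ i → i ≤ℕ m →
      B - abar m B s d a (i ∸ 1) ≤ rangeSum d (s (i ∸ 1)) n) →
    ∀ v → 1 ≤ℕ v → v ≤ℕ m →
      Σ (ℕ → ℤ) (λ x →
        (rangeSum x (s (v ∸ 1)) (s v) ≡ abar m B s d a v - abar m B s d a (v ∸ 1)) ×
        (∀ i → s (v ∸ 1) <ℕ i → i ≤ℕ s v → (0ℤ ≤ x i) × (x i ≤ d i)))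
lemma1 n m s d B a _ _ _ s-step s-last d-pos B-pos a-pos a-mono a-last feasible
       (suc w) (ℕ.s≤s ℕ.z≤n) v≤m =
  boxedRange-exists d sw≤sv 0≤d-block (proj₁ target-bounds) (proj₂ target-bounds)
  where
  sw≤sv : s w ≤ℕ s (suc w)
  sw≤sv = ℕP.<⇒≤ (s-step w v≤m)

  0≤d-block : ∀ k → s w <ℕ k → k ≤ℕ s (suc w) → 0ℤ ≤ d k
  0≤d-block k sw<k k≤sv = ℤP.<⇒≤ (d-pos k (ℕP.≤-trans (ℕ.s≤s ℕ.z≤n) sw<k)
    (ℕP.≤-trans k≤sv (subst (_ ≤ℕ_) s-last
      (≤-last m (λ i i<m → ℕP.<⇒≤ (s-step i i<m)) v≤m))))

  target-bounds : (0ℤ ≤ abar m B s d a (suc w) - abar m B s d a w) ×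
    (abar m B s d a (suc w) - abar m B s d a w ≤ rangeSum d (s w) (s (suc w)))
  target-bounds with suc w ℕ.≟ m
  ... | yes v≡m = last-target-bounds w v≡m
    (abarRec-≤ s d a w (ℤP.<⇒≤ B-pos) (λ 1≤w → a-last w 1≤w v≡m))
    (subst (λ hi → _ ≤ rangeSum d (s w) hi) (sym s-last) (feasible (suc w) (ℕ.s≤s ℕ.z≤n) v≤m))
  ... | no  v≢m = inner-target-bounds w v<m
    (rangeSum-nonneg sw≤sv 0≤d-block)
    (abarRec-≤ s d a w (ℤP.<⇒≤ (a-pos (suc w) (ℕ.s≤s ℕ.z≤n) v<m)) (λ 1≤w → a-mono w 1≤w v<m))
    where
    v<m : suc w <ℕ m
    v<m = ℕP.≤∧≢⇒< v≤m v≢m
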